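{- Let $\mathcal M=(W,W^\bot,\preccurlyeq,\sqsubseteq,V)$ be a bi-intuitionistic model, $\Sigma$ a set of formulas, and suppose $\sim$ is an equivalence relation on $W$ that is also a $\Sigma$-bisimulation. Then (i) for all $w,v\in W$, $[w]\mathrel{\preccurlyeq/\!\sim}[v]$ if and only if there is $v'\sim v$ with $w\preccurlyeq v'$; and (ii) the relation $\preccurlyeq/\!\sim$ is a preorder on $W/\!\sim$.
   Context: Language $\mathcal L$ over countably many propositional variables $\mathbb P$: $\varphi ::= p \mid \bot \mid \varphi\wedge\varphi\mid\varphi\vee\varphi\mid\varphi\to\varphi\mid\Diamond\varphi\mid\Box\varphi$. A bi-intuitionistic model $(W,W^\bot,\preccurlyeq,\sqsubseteq,V)$: $\preccurlyeq,\sqsubseteq$ preorders on $W$, $W^\bot\subseteq W$ closed upward under both, $V:\mathbb P\to2^W$ with each $V(p)$ $\preccurlyeq$-upward closed and containing $W^\bot$. Satisfaction: $w\models p$ iff $w\in V(p)$; $w\models\bot$ iff $w\in W^\bot$; $\wedge,\vee$ pointwise; $w\models\varphi\to\psi$ iff for all $v\succcurlyeq w$, $v\models\varphi$ implies $v\models\psi$; $w\models\Diamond\varphi$ iff for all $u\succcurlyeq w$ there is $v\sqsupseteq u$ with $v\models\varphi$; $w\models\Box\varphi$ iff for all $u,v$ with $w\preccurlyeq u\sqsubseteq v$, $v\models\varphi$. The $\Sigma$-label of $w$ is $\ell(w)=(\ell^+(w),\ell^\Diamond(w))$ with $\ell^+(w)=\{\varphi\in\Sigma: w\models\varphi\}$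 and $\ell^\Diamond(w)=\{\varphi\in\Sigma:\forall v\,(w\sqsubseteq v\Rightarrow v\not\models\varphi)\}$. A relation $Z\subseteq W\times W$ is forth--up confluent if $w\preccurlyeq w'$ and $w\mathrel Z v$ imply some $v'$ with $v\preccurlyeq v'$ and $w'\mathrel Z v'$; back--up confluent if $w\mathrel Z v\preccurlyeq v'$ implies some $w'$ with $w\preccurlyeq w'\mathrel Z v'$. A $\Sigma$-bisimulation is a forth--up and back--up confluent $Z$ such that $w\mathrel Z v$ implies $\ell(w)=\ell(v)$. For an equivalence relation $\sim$ on $W$ with classes $[w]$: $[w]\mathrel{\preccurlyeq/\!\sim}[v]$ iff there are $w'\sim w$ and $v'\sim v$ with $w'\preccurlyeq v'$. -}

module Defs where

open import Data.Nat using (ℕ)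
open import Data.Sum using (_⊎_)
open import Data.Product using (Σ; ∃; _×_; _,_)
open import Relation.Nullary using (¬_)
open import Relation.Binary using (Rel; IsPreorder; IsEquivalence)
open import Relation.Binary.PropositionalEquality using (_≡_)
open import Function.Bundles using (_⇔_)
open import Level using (0ℓ)

data Form : Set where
  var  : ℕ → Form
  ⊥'   : Form
  _∧'_ : Form → Form → Form
  _∨'_ : Form → Form → Form
  _⇒'_ : Form → Form → Form
  ◇'   : Form → Form
  □'   : Form → Form

record BiIntModel : Set₁ where
  field
    W     : Set
    W⊥    : W → Set
    _≼_   : Rel W 0ℓ
    _⊑_   : Rel W 0ℓ
    V     : ℕ → W → Set
    ≼-pre : IsPreorder _≡_ _≼_
    ⊑-pre : IsPreorder _≡_ _⊑_
    W⊥-≼  : ∀ {w v} → w ≼ v → W⊥ w → W⊥ v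
    W⊥-⊑  : ∀ {w v} → w ⊑ v → W⊥ w → W⊥ v
    V-≼   : ∀ p {w v} → w ≼ v → V p w → V p v
    V-W⊥  : ∀ p {w} → W⊥ w → V p w

module _ (M : BiIntModel) where
  open BiIntModel M

  _⊨_ : W → Form → Set
  w ⊨ var p   = V p w
  w ⊨ ⊥'      = W⊥ w
  w ⊨ (φ ∧' ψ) = (w ⊨ φ) × (w ⊨ ψ)
  w ⊨ (φ ∨' ψ) = (w ⊨ φ) ⊎ (w ⊨ ψ)
  w ⊨ (φ ⇒' ψ) = ∀ v → w ≼ v → v ⊨ φ → v ⊨ ψ
  w ⊨ ◇' φ    = ∀ u → w ≼ u → Σ W λ v → (u ⊑ v) × (v ⊨ φ)
  w ⊨ □' φ    = ∀ u v → w ≼ u → u ⊑ v → v ⊨ φ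

  InLabel⁺ : W → Form → Set
  InLabel⁺ w φ = w ⊨ φ

  InLabel◇ : W → Form → Set
  InLabel◇ w φ = ∀ v → w ⊑ v → ¬ (v ⊨ φ)

  SameLabel : (Form → Set) → W → W → Set
  SameLabel Σf w v =
    (∀ φ → Σf φ → InLabel⁺ w φ ⇔ InLabel⁺ v φ) ×
    (∀ φ → Σf φ → InLabel◇ w φ ⇔ InLabel◇ v φ)

  ForthUp : Rel W 0ℓ → Set
  ForthUp Z = ∀ {w w' v} → w ≼ w' → Z w v → Σ W λ v' → (v ≼ v') × Z w' v'

  BackUp : Rel W 0ℓ → Set
  BackUp Z = ∀ {w v v'} → Z w v → v ≼ v' → Σ W λ w' → (w ≼ w') × Z w' v'

  IsBisimulation : (Form → Set) → Rel W 0ℓ → Set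
  IsBisimulation Σf Z =
    ForthUp Z × BackUp Z × (∀ {w v} → Z w v → SameLabel Σf w v)

  -- The quotient W/∼ is represented by W itself with ∼ as equality
  -- (setoid); [w] ≼/∼ [v] is the following relation on representatives.
  QuotLe : Rel W 0ℓ → Rel W 0ℓ
  QuotLe _∼_ w v = Σ W λ w' → Σ W λ v' → (w' ∼ w) × (v' ∼ v) × (w' ≼ v')

module Submission where

open import Defs
open import Data.Product using (Σ; _×_; _,_)
open import Relation.Binary using (Rel; IsEquivalence; IsPreorder)
open import Function.Bundles using (_⇔_; mk⇔)
open import Level using (0ℓ)

module QuotientOrder (M : BiIntModel) {_∼_ : Rel (BiIntModel.W M) 0ℓ}
                     (∼-equiv : IsEquivalence _∼_) (backUp : BackUp M _∼_) where
  open BiIntModel M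
  open IsEquivalence ∼-equiv renaming (refl to ∼-refl; sym to ∼-sym; trans to ∼-trans)
  open IsPreorder ≼-pre renaming (refl to ≼-refl; trans to ≼-trans)

  _≼/∼_ : Rel W 0ℓ
  _≼/∼_ = QuotLe M _∼_

  ≼-ToClass : Rel W 0ℓ
  ≼-ToClass w v = Σ W λ v' → (v' ∼ v) × (w ≼ v')

  ≼/∼⇒≼-ToClass : ∀ {w v} → w ≼/∼ v → ≼-ToClass w v
  ≼/∼⇒≼-ToClass (w' , v' , w'∼w , v'∼v , w'≼v') with backUp (∼-sym w'∼w) w'≼v'
  ... | u , w≼u , u∼v' = u , ∼-trans u∼v' v'∼v , w≼u

  ≼-ToClass⇒≼/∼ : ∀ {w v} → ≼-ToClass w v → w ≼/∼ v
  ≼-ToClass⇒≼/∼ {w} (v' , v'∼v , w≼v') = w , v' , ∼-refl , v'∼v , w≼v'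

  ≼/∼⇔≼-ToClass : ∀ w v → w ≼/∼ v ⇔ ≼-ToClass w v
  ≼/∼⇔≼-ToClass w v = mk⇔ ≼/∼⇒≼-ToClass ≼-ToClass⇒≼/∼

  ≼/∼-reflexive : ∀ {w v} → w ∼ v → w ≼/∼ v
  ≼/∼-reflexive {w} w∼v = ≼-ToClass⇒≼/∼ (w , w∼v , ≼-refl)

  ≼/∼-trans : ∀ {u v w} → u ≼/∼ v → v ≼/∼ w → u ≼/∼ w
  ≼/∼-trans u≼/∼v (v' , w' , v'∼v , w'∼w , v'≼w')
    with ≼/∼⇒≼-ToClass u≼/∼v
  ... | x , x∼v , u≼x
    with ≼/∼⇒≼-ToClass (v' , w' , ∼-trans v'∼v (∼-sym x∼v) , w'∼w , v'≼w')
  ... | y , y∼w , x≼y = ≼-ToClass⇒≼/∼ (y , y∼w , ≼-trans u≼x x≼y)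

  ≼/∼-isPreorder : IsPreorder _∼_ _≼/∼_
  ≼/∼-isPreorder = record
    { isEquivalence = ∼-equiv
    ; reflexive     = ≼/∼-reflexive
    ; trans         = ≼/∼-trans
    }

mainTheorem11 : (M : BiIntModel) → (Σf : Form → Set) → (_∼_ : Rel (BiIntModel.W M) 0ℓ) →
    IsEquivalence _∼_ → IsBisimulation M Σf _∼_ →
    ((w v : BiIntModel.W M) →
      QuotLe M _∼_ w v ⇔ Σ (BiIntModel.W M) (λ v' → (v' ∼ v) × BiIntModel._≼_ M w v'))
    × IsPreorder _∼_ (QuotLe M _∼_)
mainTheorem11 M Σf _∼_ ∼-equiv (_ , backUp , _) = ≼/∼⇔≼-ToClass , ≼/∼-isPreorder
  where open QuotientOrder M ∼-equiv backUp
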